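{- Let $D$ be a star-generating digraph and let $S$ be the set of sources of $D$. Then $D - S$ is a vertex-disjoint union of directed cycles (where loops count as directed cycles of length $1$).
   Context: All digraphs are finite, may have loops, and (standing assumption) every vertex has outdegree at least $1$. A vertex $y$ is a prey of $x$ (and $x$ a predator of $y$) if $(x,y)$ is an arc. A source is a vertex of indegree $0$. $D$ is weakly connected if its underlying undirected graph is connected. A weakly connected digraph $D$ is star-generating if: ($S_1$) $D$ has at least one source and, for each source $v$, each prey of $v$ has exactly two predators; ($S_2$) no two sources of $D$ have a common prey; ($S_3$) each non-source vertex has exactly one prey and exactly two predators, one of which is a source and the other of which is a non-source vertex. -}

module Defs where

open import Data.Nat using (ℕ)
open import Data.Fin using (Fin)
open import Data.Empty using (⊥)
open import Data.Unit using (⊤)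
open import Data.Product using (Σ; ∃; ∃-syntax; _×_; _,_)
open import Data.Sum using (_⊎_)
open import Data.List using (List; []; _∷_; _∷ʳ_; concat)
open import Data.List.Membership.Propositional using (_∈_)
open import Data.List.Relation.Unary.Unique.Propositional using (Unique)
open import Relation.Nullary using (¬_)
open import Relation.Binary.PropositionalEquality using (_≡_; _≢_)
open import Relation.Binary.Construct.Closure.ReflexiveTransitive using (Star)
open import Relation.Binary.Construct.Closure.Symmetric using (SymClosure)
open import Function.Bundles using (_⇔_)

-- A finite digraph on vertex set Fin n (loops allowed, no multiple arcs):
-- Arc x y means (x , y) is an arc, i.e. y is a prey of x and x a predator of y.
record Digraph (n : ℕ) : Set₁ where
  field
    Arc : Fin n → Fin n → Set

module _ {n : ℕ} (D : Digraph n) where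
  open Digraph D

  -- standing assumption: every vertex has outdegree at least 1
  OutdegPos : Set
  OutdegPos = ∀ x → ∃[ y ] Arc x y

  IsSource : Fin n → Set
  IsSource x = ∀ y → ¬ Arc y x

  WeaklyConnected : Set
  WeaklyConnected = ∀ x y → Star (SymClosure Arc) x y

  ExactlyOnePrey : Fin n → Set
  ExactlyOnePrey x = ∃[ y ] (Arc x y × (∀ z → Arc x z → z ≡ y))

  ExactlyTwoPredators : Fin n → Set
  ExactlyTwoPredators x =
    ∃[ a ] ∃[ b ] (a ≢ b × Arc a x × Arc b x × (∀ c → Arc c x → c ≡ a ⊎ c ≡ b))

  TwoPredatorsSourceNonSource : Fin n → Set
  TwoPredatorsSourceNonSource x =
    ∃[ a ] ∃[ b ] (a ≢ b × Arc a x × Arc b x × (∀ c → Arc c x → c ≡ a ⊎ c ≡ b)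
                   × IsSource a × ¬ IsSource b)

  record StarGenerating : Set where
    field
      weakly-connected : WeaklyConnected
      S1-has-source    : ∃[ v ] IsSource v
      S1-prey          : ∀ v → IsSource v → ∀ y → Arc v y → ExactlyTwoPredators y
      S2               : ∀ v w → IsSource v → IsSource w → v ≢ w →
                           ∀ y → ¬ (Arc v y × Arc w y)
      S3-prey          : ∀ x → ¬ IsSource x → ExactlyOnePrey x
      S3-predators     : ∀ x → ¬ IsSource x → TwoPredatorsSourceNonSource x

Consecutive : {A : Set} → List A → A → A → Set
Consecutive (a ∷ b ∷ rest) x y = (x ≡ a × y ≡ b) ⊎ Consecutive (b ∷ rest) x y
Consecutive _ x y = ⊥

-- A directed cycle given by its (nonempty, distinct) vertex list v₀ … v_{k-1};
-- its arcs are vᵢ → vᵢ₊₁ and v_{k-1} → v₀ (for k = 1 this is a loop).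
CycleArc : {A : Set} → List A → A → A → Set
CycleArc [] x y = ⊥
CycleArc (a ∷ rest) x y = Consecutive ((a ∷ rest) ∷ʳ a) x y

NonEmpty : {A : Set} → List A → Set
NonEmpty [] = ⊥
NonEmpty (_ ∷ _) = ⊤

module _ {n : ℕ} (D : Digraph n) where
  open Digraph D

  IsDisjointUnionOfCyclesMinusSources : Set
  IsDisjointUnionOfCyclesMinusSources =
    Σ (List (List (Fin n))) λ cs → ((∀ {c} → c ∈ cs → NonEmpty c)
            × Unique (concat cs)
            × (∀ v → v ∈ concat cs → ¬ IsSource D v)
            × (∀ v → ¬ IsSource D v → v ∈ concat cs)
            × (∀ x y → ¬ IsSource D x → ¬ IsSource D y →
                 (Arc x y ⇔ (∃[ c ] (c ∈ cs × CycleArc c x y)))))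

-- Only (S3) is needed. Choose a prey for every vertex: this map f sends every
-- vertex to a non-source, every arc leaving a non-source x ends at f x (x has
-- a unique prey), and f is injective on non-sources (each non-source has a
-- unique non-source predator). An injective self-map of the finite set of
-- non-sources is a permutation, and its orbits are the required cycles.
module Submission where

open import Data.Nat using (ℕ; zero; suc; _+_; _∸_; _<_; s≤s)
open import Data.Nat.Properties
  using (anyUpTo?; m≤n⇒∃[o]m+o≡n; +-suc; n<1+n; m≤n+m; ≤-trans; <⇒≤; m∸n+n≡m; m<1+n⇒m<n∨m≡n)
open import Data.Nat.Induction using (<-rec)
open import Data.Fin using (Fin; toℕ; _≟_)
open import Data.Fin.Properties using (pigeonhole)
open import Data.Empty using (⊥-elim)
open import Data.Unit using (tt)
open import Data.Product using (∃; ∃-syntax; _×_; _,_; proj₁; proj₂)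
open import Data.Sum using (inj₁; inj₂)
open import Data.List using (List; []; _∷_; _∷ʳ_; concat; applyUpTo; allFin)
open import Data.List.Relation.Unary.All using (All; []; _∷_; lookup)
open import Data.List.Relation.Unary.Any using (here; there)
open import Data.List.Membership.Propositional using (_∈_; _∉_)
open import Data.List.Membership.Propositional.Properties
  using (∈-applyUpTo⁺; ∈-applyUpTo⁻; ∈-++⁺ˡ; ∈-++⁺ʳ; ∈-++⁻; ∈-concat⁻′; ∈-allFin)
open import Data.List.Relation.Unary.Unique.Propositional using (Unique; [])
open import Data.List.Relation.Unary.Unique.Propositional.Properties using (applyUpTo⁺₁; ++⁺)
open import Level using (0ℓ)
open import Relation.Unary using (Pred; Decidable)
open import Relation.Nullary using (¬_; yes; no)
open import Relation.Binary.PropositionalEquality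
  using (_≡_; _≢_; refl; sym; trans; cong; cong-app; subst; module ≡-Reasoning)
open import Function using (_∘_)
open import Function.Bundles using (_⇔_; mk⇔)
open import Defs

least-witness : {P : Pred ℕ 0ℓ} → Decidable P → ∃ P → ∃[ k ] (P k × (∀ {j} → j < k → ¬ P j))
least-witness {P} P? (m , pm) = <-rec Goal search m pm
  where
  Goal : ℕ → Set
  Goal m = P m → ∃[ k ] (P k × (∀ {j} → j < k → ¬ P j))
  search : ∀ m → (∀ {j} → j < m → Goal j) → Goal m
  search m smaller pm with anyUpTo? P? m
  ... | yes (j , j<m , pj) = smaller j<m pj
  ... | no none = m , pm , λ j<m pj → none (_ , j<m , pj)

<⇒≡+suc : ∀ {i j} → i < j → ∃[ d ] (i + suc d ≡ j)
<⇒≡+suc {i} i<j = let d , eq = m≤n⇒∃[o]m+o≡n i<j in d , trans (+-suc i d) eq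

module _ {A : Set} where

  consecutive-applyUpTo⁺ : ∀ (h : ℕ → A) {m i} → i < m →
                           Consecutive (applyUpTo h m ∷ʳ h m) (h i) (h (suc i))
  consecutive-applyUpTo⁺ h {suc zero}    {zero}  _          = inj₁ (refl , refl)
  consecutive-applyUpTo⁺ h {suc zero}    {suc i} (s≤s ())
  consecutive-applyUpTo⁺ h {suc (suc m)} {zero}  _          = inj₁ (refl , refl)
  consecutive-applyUpTo⁺ h {suc (suc m)} {suc i} (s≤s i<m) = inj₂ (consecutive-applyUpTo⁺ (h ∘ suc) i<m)

  consecutive-applyUpTo⁻ : ∀ (h : ℕ → A) m {x y} → Consecutive (applyUpTo h m ∷ʳ h m) x y →
                           ∃[ i ] (x ≡ h i × y ≡ h (suc i))
  consecutive-applyUpTo⁻ h zero          ()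
  consecutive-applyUpTo⁻ h (suc zero)    (inj₁ eqs) = 0 , eqs
  consecutive-applyUpTo⁻ h (suc zero)    (inj₂ ())
  consecutive-applyUpTo⁻ h (suc (suc m)) (inj₁ eqs) = 0 , eqs
  consecutive-applyUpTo⁻ h (suc (suc m)) (inj₂ c)   =
    let i , eqs = consecutive-applyUpTo⁻ (h ∘ suc) (suc m) c in suc i , eqs

module OrbitDecomposition {n : ℕ} (f : Fin n → Fin n) {P : Pred (Fin n) 0ℓ} (P? : Decidable P)
  (f-preserves : ∀ {x} → P x → P (f x))
  (f-injective : ∀ {x y} → P x → P y → f x ≡ f y → x ≡ y) where

  open import Function.Endo.Propositional (Fin n) using (_^_; ^-homo)
  open import Data.List.Membership.DecPropositional (_≟_ {n}) using (_∈?_)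

  ^-+ : ∀ i j x → (f ^ (i + j)) x ≡ (f ^ i) ((f ^ j) x)
  ^-+ i j = cong-app (^-homo f i j)

  ^-preserves : ∀ i {x} → P x → P ((f ^ i) x)
  ^-preserves zero    px = px
  ^-preserves (suc i) px = f-preserves (^-preserves i px)

  ^-injective : ∀ i {x y} → P x → P y → (f ^ i) x ≡ (f ^ i) y → x ≡ y
  ^-injective zero    _  _  eq = eq
  ^-injective (suc i) px py eq = ^-injective i px py (f-injective (^-preserves i px) (^-preserves i py) eq)

  ^-cancel : ∀ i d {x} → P x → (f ^ i) x ≡ (f ^ (i + d)) x → x ≡ (f ^ d) x
  ^-cancel i d {x} px eq = ^-injective i px (^-preserves d px) (trans eq (^-+ i d x))

  returns : ∀ {u} → P u → ∃[ k ] ((f ^ suc k) u ≡ u)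
  returns {u} pu =
    let i , j , i<j , eq = pigeonhole (n<1+n n) (λ i → (f ^ toℕ i) u)
        d , j≡ = <⇒≡+suc i<j
    in d , sym (^-cancel (toℕ i) (suc d) pu (trans eq (cong (λ t → (f ^ t) u) (sym j≡))))

  Period : Fin n → ℕ → Set
  Period u k = (f ^ suc k) u ≡ u × (∀ {j} → j < k → (f ^ suc j) u ≢ u)

  period : ∀ {u} → P u → ∃ (Period u)
  period {u} pu = least-witness (λ k → (f ^ suc k) u ≟ u) (returns pu)

  orbit : Fin n → ℕ → List (Fin n)
  orbit u = applyUpTo (λ i → (f ^ i) u)

  orbit-unique : ∀ {u k} → P u → Period u k → Unique (orbit u (suc k))
  orbit-unique {u} {k} pu (_ , minimal) = applyUpTo⁺₁ _ (suc k) distinct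
    where
    distinct : ∀ {i j} → i < j → j < suc k → (f ^ i) u ≢ (f ^ j) u
    distinct {i} i<j (s≤s j≤k) eq with d , refl ← <⇒≡+suc i<j =
      minimal (≤-trans (m≤n+m (suc d) i) j≤k) (sym (^-cancel i (suc d) pu eq))

  data IsCycle : List (Fin n) → Set where
    cycle : ∀ {u} k → P u → (f ^ suc k) u ≡ u → IsCycle (orbit u (suc k))

  Closed : List (Fin n) → Set
  Closed S = ∀ {x} → x ∈ S → f x ∈ S

  ^-closed : ∀ {S x} → Closed S → x ∈ S → ∀ m → (f ^ m) x ∈ S
  ^-closed closed x∈ zero    = x∈
  ^-closed closed x∈ (suc m) = closed (^-closed closed x∈ m)

  module _ {c : List (Fin n)} where

    cycle-nonEmpty : IsCycle c → NonEmpty c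
    cycle-nonEmpty (cycle _ _ _) = tt

    cycle-⊆ : IsCycle c → ∀ {x} → x ∈ c → P x
    cycle-⊆ (cycle {u} _ pu _) x∈ with i , _ , refl ← ∈-applyUpTo⁻ (λ i → (f ^ i) u) x∈ = ^-preserves i pu

    cycle-closed : IsCycle c → Closed c
    cycle-closed (cycle {u} k _ closes) x∈ with ∈-applyUpTo⁻ (λ i → (f ^ i) u) x∈
    ... | i , i<1+k , refl with m<1+n⇒m<n∨m≡n i<1+k
    ...   | inj₁ i<k   = ∈-applyUpTo⁺ (λ i → (f ^ i) u) (s≤s i<k)
    ...   | inj₂ refl = subst (_∈ orbit u (suc k)) (sym closes) (here refl)

    cycle-reachable : IsCycle c → ∀ {x y} → x ∈ c → y ∈ c → ∃[ m ] ((f ^ m) x ≡ y)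
    cycle-reachable (cycle {u} k _ closes) x∈ y∈
      with i , i<1+k , refl ← ∈-applyUpTo⁻ (λ i → (f ^ i) u) x∈
      with j , _ , refl ← ∈-applyUpTo⁻ (λ i → (f ^ i) u) y∈ = j + (suc k ∸ i) , (begin
        (f ^ (j + (suc k ∸ i))) ((f ^ i) u)   ≡⟨ ^-+ j _ _ ⟩
        (f ^ j) ((f ^ (suc k ∸ i)) ((f ^ i) u)) ≡⟨ cong (f ^ j) (sym (^-+ (suc k ∸ i) i u)) ⟩
        (f ^ j) ((f ^ (suc k ∸ i + i)) u)     ≡⟨ cong (λ t → (f ^ j) ((f ^ t) u)) (m∸n+n≡m (<⇒≤ i<1+k)) ⟩
        (f ^ j) ((f ^ suc k) u)               ≡⟨ cong (f ^ j) closes ⟩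
        (f ^ j) u                             ∎)
      where open ≡-Reasoning

    cycle-meets⇒⊆ : IsCycle c → ∀ {S} → Closed S → ∀ {x} → x ∈ c → x ∈ S → ∀ {y} → y ∈ c → y ∈ S
    cycle-meets⇒⊆ cyc closed x∈c x∈S y∈c =
      let m , fᵐx≡y = cycle-reachable cyc x∈c y∈c in subst (_∈ _) fᵐx≡y (^-closed closed x∈S m)

    cycleArc-f : IsCycle c → ∀ {x} → x ∈ c → CycleArc c x (f x)
    cycleArc-f (cycle {u} k _ closes) x∈ with i , i<1+k , refl ← ∈-applyUpTo⁻ (λ i → (f ^ i) u) x∈ =
      subst (λ z → Consecutive (orbit u (suc k) ∷ʳ z) ((f ^ i) u) (f ((f ^ i) u))) closes
            (consecutive-applyUpTo⁺ (λ i → (f ^ i) u) i<1+k)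

    cycleArc⇒≡f : IsCycle c → ∀ {x y} → CycleArc c x y → y ≡ f x
    cycleArc⇒≡f (cycle {u} k _ closes) arc
      with _ , refl , refl ← consecutive-applyUpTo⁻ (λ i → (f ^ i) u) (suc k)
             (subst (λ z → Consecutive (orbit u (suc k) ∷ʳ z) _ _) (sym closes) arc) = refl

  cycles-closed : ∀ {cs} → All IsCycle cs → Closed (concat cs)
  cycles-closed {c ∷ _} (cyc ∷ cycs) x∈ with ∈-++⁻ c x∈
  ... | inj₁ x∈c  = ∈-++⁺ˡ (cycle-closed cyc x∈c)
  ... | inj₂ x∈cs = ∈-++⁺ʳ c (cycles-closed cycs x∈cs)

  record Decomposition (vs : List (Fin n)) : Set where
    field
      cycles     : List (List (Fin n))
      all-cycles : All IsCycle cycles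
      disjoint   : Unique (concat cycles)
      covers     : ∀ {v} → v ∈ vs → P v → v ∈ concat cycles

  covers-∷ : ∀ {S v vs} → (P v → v ∈ S) → (∀ {w} → w ∈ vs → P w → w ∈ S) →
             ∀ {w} → w ∈ v ∷ vs → P w → w ∈ S
  covers-∷ new old (here refl) = new
  covers-∷ new old (there w∈)  = old w∈

  extend : ∀ {v vs} (d : Decomposition vs) → (P v → v ∈ concat (Decomposition.cycles d)) →
           Decomposition (v ∷ vs)
  extend d new = record
    { cycles = cycles ; all-cycles = all-cycles ; disjoint = disjoint ; covers = covers-∷ new covers }
    where open Decomposition d

  add-orbit : ∀ {v k vs} → P v → Period v k → (d : Decomposition vs) →
              v ∉ concat (Decomposition.cycles d) → Decomposition (v ∷ vs)
  add-orbit {v} {k} pv per d v∉ = record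
    { cycles     = orbit v (suc k) ∷ cycles
    ; all-cycles = cyc ∷ all-cycles
    ; disjoint   = ++⁺ (orbit-unique pv per) disjoint
                       (λ (w∈c , w∈cs) → v∉ (cycle-meets⇒⊆ cyc (cycles-closed all-cycles) w∈c w∈cs (here refl)))
    ; covers     = covers-∷ (λ _ → here refl) (λ w∈ pw → ∈-++⁺ʳ (orbit v (suc k)) (covers w∈ pw))
    }
    where
    open Decomposition d
    cyc : IsCycle (orbit v (suc k))
    cyc = cycle k pv (proj₁ per)

  decompose : ∀ vs → Decomposition vs
  decompose [] = record { cycles = [] ; all-cycles = [] ; disjoint = [] ; covers = λ () }
  decompose (v ∷ vs) with decompose vs | P? v
  ... | d | no ¬pv = extend d (⊥-elim ∘ ¬pv)
  ... | d | yes pv with v ∈? concat (Decomposition.cycles d)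
  ...   | yes v∈ = extend d (λ _ → v∈)
  ...   | no v∉  = add-orbit pv (proj₂ (period pv)) d v∉

arc⇒¬IsSource : ∀ {n} {D : Digraph n} {x y} → Digraph.Arc D x y → ¬ IsSource D y
arc⇒¬IsSource {x = x} arc isSource = isSource x arc

module StarGeneratingPrey {n : ℕ} {D : Digraph n} (outdeg : OutdegPos D) (sg : StarGenerating D) where
  open Digraph D
  open StarGenerating sg

  prey : Fin n → Fin n
  prey x = proj₁ (outdeg x)

  prey-arc : ∀ x → Arc x (prey x)
  prey-arc x = proj₂ (outdeg x)

  prey-nonSource : ∀ x → ¬ IsSource D (prey x)
  prey-nonSource x = arc⇒¬IsSource {D = D} (prey-arc x)

  arc⇒≡prey : ∀ {x y} → ¬ IsSource D x → Arc x y → y ≡ prey x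
  arc⇒≡prey {x} nsx arc = let _ , _ , only = S3-prey x nsx in trans (only _ arc) (sym (only _ (prey-arc x)))

  nonSource? : Decidable (λ v → ¬ IsSource D v)
  nonSource? v with _ , _ , _ , _ , _ , only , srcA , nsB ← S3-predators (prey v) (prey-nonSource v)
                  | only v (prey-arc v)
  ... | inj₁ refl = no (λ nsv → nsv srcA)
  ... | inj₂ refl = yes nsB

  prey-injective : ∀ {x y} → ¬ IsSource D x → ¬ IsSource D y → prey x ≡ prey y → x ≡ y
  prey-injective {x} {y} nsx nsy eq
    with _ , _ , _ , _ , _ , only , srcA , _ ← S3-predators (prey x) (prey-nonSource x)
       | only x (prey-arc x) | only y (subst (Arc y) (sym eq) (prey-arc y))
  ... | inj₁ refl | _         = ⊥-elim (nsx srcA)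
  ... | _         | inj₁ refl = ⊥-elim (nsy srcA)
  ... | inj₂ x≡b  | inj₂ y≡b  = trans x≡b (sym y≡b)

lemma3p1 : ∀ {n : ℕ} (D : Digraph n) → OutdegPos D → StarGenerating D →
    IsDisjointUnionOfCyclesMinusSources D
lemma3p1 {n} D outdeg sg =
  cycles , cycle-nonEmpty ∘ lookup all-cycles , disjoint , nonSource , covered , arcs
  where
  open Digraph D
  open StarGeneratingPrey outdeg sg
  open OrbitDecomposition prey nonSource? (λ {x} _ → prey-nonSource x) prey-injective
  open Decomposition (decompose (allFin n))

  nonSource : ∀ v → v ∈ concat cycles → ¬ IsSource D v
  nonSource v v∈ = let c , v∈c , c∈ = ∈-concat⁻′ cycles v∈ in cycle-⊆ (lookup all-cycles c∈) v∈c

  covered : ∀ v → ¬ IsSource D v → v ∈ concat cycles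
  covered v = covers (∈-allFin v)

  arcs : ∀ x y → ¬ IsSource D x → ¬ IsSource D y → Arc x y ⇔ (∃[ c ] (c ∈ cycles × CycleArc c x y))
  arcs x y nsx _ = mk⇔
    (λ arc → let c , x∈c , c∈ = ∈-concat⁻′ cycles (covered x nsx) in
      c , c∈ , subst (CycleArc c x) (sym (arc⇒≡prey nsx arc)) (cycleArc-f (lookup all-cycles c∈) x∈c))
    (λ (c , c∈ , arc) → subst (Arc x) (sym (cycleArc⇒≡f (lookup all-cycles c∈) arc)) (prey-arc x))
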